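{- Fix $m\ge0$. Let $u_0=G$, $u_1=F$, $u_2=(F+G)^2G$, let $L$ be the $\mathbb{Z}/2$-span of the $u_iG^{2n}$ with $0\le i\le 2$, $0\le n\le m$, and let $L^*=\{(r^2+r)g(r^2): g\in\mathbb{Z}/2[t],\ \deg g\le 4m+3\}$. Then $\dim_{\mathbb{Z}/2}L=3m+3$ and $L\subseteq L^*$.
   Context: $\mathbb{Z}/2[r]$, $\mathbb{Z}/2[t]$ are polynomial rings over the field with two elements; $F=r(r+1)^3$, $G=r^3(r+1)$. -}

module Defs where

open import Data.Bool using (Bool; true; false; _xor_; _∧_)
open import Data.List using (List; []; _∷_)
open import Data.Nat using (ℕ; zero; suc; _*_; _+_)
open import Data.Fin using (Fin)
open import Data.Vec using (Vec; toList)
open import Data.Product using (Σ; Σ-syntax; _×_)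
open import Relation.Binary.PropositionalEquality using (_≡_)

-- Polynomials over ℤ/2 as coefficient lists (constant term first).
-- Trailing zeros are allowed; equality is coefficientwise (_≈ᵖ_).
Poly : Set
Poly = List Bool

coeff : Poly → ℕ → Bool
coeff []      _       = false
coeff (a ∷ p) zero    = a
coeff (a ∷ p) (suc n) = coeff p n

infix 4 _≈ᵖ_
_≈ᵖ_ : Poly → Poly → Set
p ≈ᵖ q = ∀ n → coeff p n ≡ coeff q n

0ᵖ : Poly
0ᵖ = []

1ᵖ : Poly
1ᵖ = true ∷ []

X : Poly
X = false ∷ true ∷ []

infixl 6 _+ᵖ_
infixl 7 _*ᵖ_
infixr 8 _^ᵖ_

_+ᵖ_ : Poly → Poly → Poly
[]      +ᵖ q       = q
(a ∷ p) +ᵖ []      = a ∷ p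
(a ∷ p) +ᵖ (b ∷ q) = (a xor b) ∷ (p +ᵖ q)

scale : Bool → Poly → Poly
scale c []      = []
scale c (a ∷ p) = (c ∧ a) ∷ scale c p

_*ᵖ_ : Poly → Poly → Poly
[]      *ᵖ q = []
(a ∷ p) *ᵖ q = scale a q +ᵖ (false ∷ (p *ᵖ q))

_^ᵖ_ : Poly → ℕ → Poly
p ^ᵖ zero  = 1ᵖ
p ^ᵖ suc n = p *ᵖ (p ^ᵖ n)

compose : Poly → Poly → Poly
compose []      q = []
compose (a ∷ p) q = (a ∷ []) +ᵖ q *ᵖ compose p q

F : Poly
F = X *ᵖ (X +ᵖ 1ᵖ) ^ᵖ 3

G : Poly
G = X ^ᵖ 3 *ᵖ (X +ᵖ 1ᵖ)

u : Fin 3 → Poly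
u Fin.zero             = G
u (Fin.suc Fin.zero)   = F
u (Fin.suc (Fin.suc Fin.zero)) = (F +ᵖ G) ^ᵖ 2 *ᵖ G

sumᵖ : (k : ℕ) → (Fin k → Poly) → Poly
sumᵖ zero    f = 0ᵖ
sumᵖ (suc k) f = f Fin.zero +ᵖ sumᵖ k (λ j → f (Fin.suc j))

lincomb : {k : ℕ} → (Fin k → Bool) → (Fin k → Poly) → Poly
lincomb {k} c v = sumᵖ k (λ j → scale (c j) (v j))

LinIndep : {k : ℕ} → (Fin k → Poly) → Set
LinIndep {k} v = (c : Fin k → Bool) → lincomb c v ≈ᵖ 0ᵖ → ∀ j → c j ≡ false

InSpan : {k : ℕ} → (Fin k → Poly) → Poly → Set
InSpan {k} v p = Σ[ c ∈ (Fin k → Bool) ] p ≈ᵖ lincomb c v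

HasDim : (Poly → Set) → ℕ → Set
HasDim S d = Σ[ b ∈ (Fin d → Poly) ]
  ((∀ j → S (b j)) × LinIndep b × (∀ p → S p → InSpan b p))

L : ℕ → Poly → Set
L m p = Σ[ c ∈ (Fin 3 → Fin (suc m) → Bool) ]
  p ≈ᵖ sumᵖ 3 (λ i → sumᵖ (suc m) (λ n →
         scale (c i n) (u i *ᵖ G ^ᵖ (2 * Data.Fin.toℕ n))))

-- L* = {(r^2+r) g(r^2) : deg g ≤ 4m+3}; g given by its 4m+4 coefficients
L* : ℕ → Poly → Set
L* m p = Σ[ g ∈ Vec Bool (4 * m + 4) ]
  p ≈ᵖ (X ^ᵖ 2 +ᵖ X) *ᵖ compose (toList g) (X ^ᵖ 2)

-- Multiplication by G² = r⁶(1+r²) is injective and kills every coefficient below r⁶, while the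
-- coefficients of r, r³, r⁵ in a₀u₀ + a₁u₁ + a₂u₂ are a₁, a₀+a₁, a₂. Writing a vanishing combination
-- of the u_i G^{2n} as (n = 0 part) + G²·(combination for m−1) therefore forces the n = 0 coefficients
-- to vanish, and induction on m shows that the 3m+3 spanning vectors are independent.
-- For the inclusion, (r²+r)g(r²) is the polynomial with coefficients 0, g₀, g₀, g₁, g₁, …; these form
-- a subspace containing u₀, u₁, u₂ with deg g ≤ 3, and since G² = (t³+t⁴)(r²), multiplying by G²
-- raises the admissible degree of g by 4.
{-# OPTIONS --safe #-}
module Submission where

open import Defs
open import Level using (0ℓ)
open import Algebra.Bundles using (CommutativeMonoid; CommutativeSemiring)
open import Algebra.Structures.Biased using (isCommutativeMonoidˡ; isCommutativeSemiringʳ)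
open import Data.Bool using (Bool; true; false; _xor_; _∧_)
open import Data.Bool.Properties using (xor-assoc; xor-comm; xor-identityʳ; ∧-zeroʳ; ∧-comm; ∧-assoc; ∧-distribˡ-xor)
open import Data.Fin using (Fin; zero; suc; toℕ; _↑ˡ_; _↑ʳ_; combine; remQuot)
open import Data.Fin.Properties using (_≟_; remQuot-combine; combine-remQuot)
open import Data.List using (List; []; _∷_; length)
open import Data.Nat using (ℕ; zero; suc; _+_; _*_; _⊔_; _≤_; z≤n; s≤s)
open import Data.Nat.Properties using (*-suc; +-comm; ≤-trans; ≤-reflexive; ⊔-lub; m≤n⇒m≤1+n; m≤m*n)
open import Data.Product using (Σ-syntax; _×_; _,_; proj₁; proj₂; uncurry)
open import Data.Vec using (Vec; toList; fromList; padRight)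
import Data.Vec as Vec
open import Relation.Nullary using (does)
open import Relation.Binary.Bundles using (Setoid)
open import Relation.Binary.Structures using (IsEquivalence)
open import Relation.Binary.PropositionalEquality using (_≡_; refl; sym; trans; cong; cong₂; subst)

-- ℤ/2[r] as a commutative semiring

infix 4 _≋_
record _≋_ (p q : Poly) : Set where
  constructor coeffwise
  field at : p ≈ᵖ q
open _≋_

≋-isEquivalence : IsEquivalence _≋_
≋-isEquivalence = record
  { refl  = coeffwise λ _ → refl
  ; sym   = λ e → coeffwise λ n → sym (at e n)
  ; trans = λ e f → coeffwise λ n → trans (at e n) (at f n)
  }

≋-setoid : Setoid 0ℓ 0ℓ
≋-setoid = record { isEquivalence = ≋-isEquivalence }

open Setoid ≋-setoid using () renaming (refl to ≋-refl; sym to ≋-sym; trans to ≋-trans; reflexive to ≋-reflexive)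
open import Relation.Binary.Reasoning.Setoid ≋-setoid

coeff-+ : ∀ p q n → coeff (p +ᵖ q) n ≡ coeff p n xor coeff q n
coeff-+ []      q       n       = refl
coeff-+ (a ∷ p) []      n       = sym (xor-identityʳ _)
coeff-+ (a ∷ p) (b ∷ q) zero    = refl
coeff-+ (a ∷ p) (b ∷ q) (suc n) = coeff-+ p q n

coeff-scale : ∀ a p n → coeff (scale a p) n ≡ a ∧ coeff p n
coeff-scale a []      n       = sym (∧-zeroʳ a)
coeff-scale a (b ∷ p) zero    = refl
coeff-scale a (b ∷ p) (suc n) = coeff-scale a p n

∷-cong : ∀ {a b p q} → a ≡ b → p ≋ q → a ∷ p ≋ b ∷ q
∷-cong a≡b p≋q = coeffwise λ { zero → a≡b ; (suc n) → at p≋q n }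

false∷-≋0 : ∀ {p} → p ≋ 0ᵖ → false ∷ p ≋ 0ᵖ
false∷-≋0 p≋0 = coeffwise λ { zero → refl ; (suc n) → at p≋0 n }

+ᵖ-cong : ∀ {p p′ q q′} → p ≋ p′ → q ≋ q′ → p +ᵖ q ≋ p′ +ᵖ q′
+ᵖ-cong {p} {p′} {q} {q′} p≋p′ q≋q′ = coeffwise λ n →
  trans (coeff-+ p q n) (trans (cong₂ _xor_ (at p≋p′ n) (at q≋q′ n)) (sym (coeff-+ p′ q′ n)))

scale-cong : ∀ a {p q} → p ≋ q → scale a p ≋ scale a q
scale-cong a {p} {q} p≋q = coeffwise λ n →
  trans (coeff-scale a p n) (trans (cong (a ∧_) (at p≋q n)) (sym (coeff-scale a q n)))

+ᵖ-identityʳ : ∀ p → p +ᵖ 0ᵖ ≋ p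
+ᵖ-identityʳ []      = ≋-refl
+ᵖ-identityʳ (a ∷ p) = ≋-refl

+ᵖ-comm : ∀ p q → p +ᵖ q ≋ q +ᵖ p
+ᵖ-comm []      q       = ≋-sym (+ᵖ-identityʳ q)
+ᵖ-comm (a ∷ p) []      = ≋-refl
+ᵖ-comm (a ∷ p) (b ∷ q) = ∷-cong (xor-comm a b) (+ᵖ-comm p q)

+ᵖ-assoc : ∀ p q r → (p +ᵖ q) +ᵖ r ≋ p +ᵖ (q +ᵖ r)
+ᵖ-assoc []      q       r       = ≋-refl
+ᵖ-assoc (a ∷ p) []      r       = ≋-refl
+ᵖ-assoc (a ∷ p) (b ∷ q) []      = ≋-refl
+ᵖ-assoc (a ∷ p) (b ∷ q) (c ∷ r) = ∷-cong (xor-assoc a b c) (+ᵖ-assoc p q r)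

+ᵖ-commutativeMonoid : CommutativeMonoid 0ℓ 0ℓ
+ᵖ-commutativeMonoid = record
  { isCommutativeMonoid = isCommutativeMonoidˡ record
    { isSemigroup = record
      { isMagma = record { isEquivalence = ≋-isEquivalence ; ∙-cong = +ᵖ-cong }
      ; assoc   = +ᵖ-assoc
      }
    ; identityˡ = λ _ → ≋-refl
    ; comm      = +ᵖ-comm
    }
  }

open import Algebra.Properties.CommutativeSemigroup (CommutativeMonoid.commutativeSemigroup +ᵖ-commutativeMonoid)
  using () renaming (interchange to +ᵖ-interchange; x∙yz≈y∙xz to +ᵖ-leftComm)

scale-true : ∀ p → scale true p ≡ p
scale-true []      = refl
scale-true (a ∷ p) = cong (a ∷_) (scale-true p)

scale-false : ∀ p → scale false p ≋ 0ᵖ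
scale-false p = coeffwise (coeff-scale false p)

scale-∧ : ∀ a b p → scale a (scale b p) ≡ scale (a ∧ b) p
scale-∧ a b []      = refl
scale-∧ a b (c ∷ p) = cong₂ _∷_ (sym (∧-assoc a b c)) (scale-∧ a b p)

scale-+ᵖ : ∀ a p q → scale a (p +ᵖ q) ≋ scale a p +ᵖ scale a q
scale-+ᵖ a []      q       = ≋-refl
scale-+ᵖ a (b ∷ p) []      = ≋-refl
scale-+ᵖ a (b ∷ p) (c ∷ q) = ∷-cong (∧-distribˡ-xor a b c) (scale-+ᵖ a p q)

*ᵖ-zeroʳ : ∀ p → p *ᵖ 0ᵖ ≋ 0ᵖ
*ᵖ-zeroʳ []      = ≋-refl
*ᵖ-zeroʳ (a ∷ p) = false∷-≋0 (*ᵖ-zeroʳ p)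

*ᵖ-congʳ : ∀ p {q q′} → q ≋ q′ → p *ᵖ q ≋ p *ᵖ q′
*ᵖ-congʳ []      q≋q′ = ≋-refl
*ᵖ-congʳ (a ∷ p) q≋q′ = +ᵖ-cong (scale-cong a q≋q′) (∷-cong refl (*ᵖ-congʳ p q≋q′))

false∷-*ᵖ : ∀ p q → (false ∷ p) *ᵖ q ≋ false ∷ p *ᵖ q
false∷-*ᵖ p q = +ᵖ-cong (scale-false q) ≋-refl

*ᵖ-identityˡ : ∀ q → 1ᵖ *ᵖ q ≋ q
*ᵖ-identityˡ q = begin
  scale true q +ᵖ (false ∷ [])  ≈⟨ +ᵖ-cong (≋-reflexive (scale-true q)) (false∷-≋0 ≋-refl) ⟩
  q +ᵖ 0ᵖ                       ≈⟨ +ᵖ-identityʳ q ⟩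
  q                             ∎

*ᵖ-∷ʳ : ∀ p b q → p *ᵖ (b ∷ q) ≋ scale b p +ᵖ (false ∷ p *ᵖ q)
*ᵖ-∷ʳ []      b q = ≋-sym (false∷-≋0 ≋-refl)
*ᵖ-∷ʳ (a ∷ p) b q = ∷-cong (cong (_xor false) (∧-comm a b)) (begin
  scale a q +ᵖ p *ᵖ (b ∷ q)                         ≈⟨ +ᵖ-cong ≋-refl (*ᵖ-∷ʳ p b q) ⟩
  scale a q +ᵖ (scale b p +ᵖ (false ∷ p *ᵖ q))      ≈⟨ +ᵖ-leftComm (scale a q) (scale b p) _ ⟩
  scale b p +ᵖ (scale a q +ᵖ (false ∷ p *ᵖ q))      ∎)

*ᵖ-comm : ∀ p q → p *ᵖ q ≋ q *ᵖ p
*ᵖ-comm []      q = ≋-sym (*ᵖ-zeroʳ q)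
*ᵖ-comm (a ∷ p) q = begin
  scale a q +ᵖ (false ∷ p *ᵖ q)   ≈⟨ +ᵖ-cong ≋-refl (∷-cong refl (*ᵖ-comm p q)) ⟩
  scale a q +ᵖ (false ∷ q *ᵖ p)   ≈⟨ *ᵖ-∷ʳ q a p ⟨
  q *ᵖ (a ∷ p)                    ∎

*ᵖ-cong : ∀ {p p′ q q′} → p ≋ p′ → q ≋ q′ → p *ᵖ q ≋ p′ *ᵖ q′
*ᵖ-cong {p} {p′} {q} {q′} p≋p′ q≋q′ = begin
  p *ᵖ q    ≈⟨ *ᵖ-congʳ p q≋q′ ⟩
  p *ᵖ q′   ≈⟨ *ᵖ-comm p q′ ⟩
  q′ *ᵖ p   ≈⟨ *ᵖ-congʳ q′ p≋p′ ⟩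
  q′ *ᵖ p′  ≈⟨ *ᵖ-comm q′ p′ ⟩
  p′ *ᵖ q′  ∎

*ᵖ-distribˡ : ∀ p q r → p *ᵖ (q +ᵖ r) ≋ p *ᵖ q +ᵖ p *ᵖ r
*ᵖ-distribˡ []      q r = ≋-refl
*ᵖ-distribˡ (a ∷ p) q r = begin
  scale a (q +ᵖ r) +ᵖ (false ∷ p *ᵖ (q +ᵖ r))
    ≈⟨ +ᵖ-cong (scale-+ᵖ a q r) (∷-cong refl (*ᵖ-distribˡ p q r)) ⟩
  (scale a q +ᵖ scale a r) +ᵖ ((false ∷ p *ᵖ q) +ᵖ (false ∷ p *ᵖ r))
    ≈⟨ +ᵖ-interchange (scale a q) (scale a r) _ _ ⟩
  (scale a q +ᵖ (false ∷ p *ᵖ q)) +ᵖ (scale a r +ᵖ (false ∷ p *ᵖ r))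
    ∎

*ᵖ-distribʳ : ∀ p q r → (q +ᵖ r) *ᵖ p ≋ q *ᵖ p +ᵖ r *ᵖ p
*ᵖ-distribʳ p q r = begin
  (q +ᵖ r) *ᵖ p          ≈⟨ *ᵖ-comm (q +ᵖ r) p ⟩
  p *ᵖ (q +ᵖ r)          ≈⟨ *ᵖ-distribˡ p q r ⟩
  p *ᵖ q +ᵖ p *ᵖ r       ≈⟨ +ᵖ-cong (*ᵖ-comm p q) (*ᵖ-comm p r) ⟩
  q *ᵖ p +ᵖ r *ᵖ p       ∎

scale-*ᵖ : ∀ a p q → scale a p *ᵖ q ≋ scale a (p *ᵖ q)
scale-*ᵖ a []      q = ≋-refl
scale-*ᵖ a (b ∷ p) q = begin
  scale (a ∧ b) q +ᵖ (false ∷ scale a p *ᵖ q)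
    ≈⟨ +ᵖ-cong (≋-reflexive (sym (scale-∧ a b q))) (∷-cong (sym (∧-zeroʳ a)) (scale-*ᵖ a p q)) ⟩
  scale a (scale b q) +ᵖ scale a (false ∷ p *ᵖ q)
    ≈⟨ scale-+ᵖ a (scale b q) _ ⟨
  scale a (scale b q +ᵖ (false ∷ p *ᵖ q))
    ∎

*ᵖ-assoc : ∀ p q r → (p *ᵖ q) *ᵖ r ≋ p *ᵖ (q *ᵖ r)
*ᵖ-assoc []      q r = ≋-refl
*ᵖ-assoc (a ∷ p) q r = begin
  (scale a q +ᵖ (false ∷ p *ᵖ q)) *ᵖ r       ≈⟨ *ᵖ-distribʳ r (scale a q) _ ⟩
  scale a q *ᵖ r +ᵖ (false ∷ p *ᵖ q) *ᵖ r    ≈⟨ +ᵖ-cong (scale-*ᵖ a q r) (false∷-*ᵖ (p *ᵖ q) r) ⟩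
  scale a (q *ᵖ r) +ᵖ (false ∷ (p *ᵖ q) *ᵖ r) ≈⟨ +ᵖ-cong ≋-refl (∷-cong refl (*ᵖ-assoc p q r)) ⟩
  scale a (q *ᵖ r) +ᵖ (false ∷ p *ᵖ (q *ᵖ r)) ∎

ℤ₂[r]-commutativeSemiring : CommutativeSemiring 0ℓ 0ℓ
ℤ₂[r]-commutativeSemiring = record
  { _+_ = _+ᵖ_
  ; _*_ = _*ᵖ_
  ; 0#  = 0ᵖ
  ; 1#  = 1ᵖ
  ; isCommutativeSemiring = isCommutativeSemiringʳ record
    { +-isCommutativeMonoid = CommutativeMonoid.isCommutativeMonoid +ᵖ-commutativeMonoid
    ; *-isCommutativeMonoid = isCommutativeMonoidˡ record
      { isSemigroup = record
        { isMagma = record { isEquivalence = ≋-isEquivalence ; ∙-cong = *ᵖ-cong }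
        ; assoc   = *ᵖ-assoc
        }
      ; identityˡ = *ᵖ-identityˡ
      ; comm      = *ᵖ-comm
      }
    ; distribˡ = *ᵖ-distribˡ
    ; zeroʳ    = *ᵖ-zeroʳ
    }
  }

open CommutativeSemiring ℤ₂[r]-commutativeSemiring using (semiring; *-commutativeSemigroup)
open import Algebra.Properties.CommutativeSemigroup *-commutativeSemigroup
  using () renaming (x∙yz≈y∙xz to *ᵖ-leftComm)
open import Algebra.Properties.Semiring.Sum semiring
  using (sum; sum-cong-≋; sum-replicate-zero; ∑-distrib-+; *-distribˡ-sum)

xor≡false⇒≡ : ∀ a b → a xor b ≡ false → a ≡ b
xor≡false⇒≡ false b    a⊕b≡0 = sym a⊕b≡0
xor≡false⇒≡ true  true  _     = refl
xor≡false⇒≡ true  false ()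

+ᵖ≋0⇒≋ : ∀ {p q} → p +ᵖ q ≋ 0ᵖ → p ≋ q
+ᵖ≋0⇒≋ {p} {q} p+q≋0 = coeffwise λ n →
  xor≡false⇒≡ (coeff p n) (coeff q n) (trans (sym (coeff-+ p q n)) (at p+q≋0 n))

*ᵖ-scale : ∀ a p q → scale a (p *ᵖ q) ≋ p *ᵖ scale a q
*ᵖ-scale a p q = begin
  scale a (p *ᵖ q)   ≈⟨ scale-cong a (*ᵖ-comm p q) ⟩
  scale a (q *ᵖ p)   ≈⟨ scale-*ᵖ a q p ⟨
  scale a q *ᵖ p     ≈⟨ *ᵖ-comm (scale a q) p ⟩
  p *ᵖ scale a q     ∎

-- Multiplication by r^k and by G²

shift : ℕ → Poly → Poly
shift zero    p = p
shift (suc k) p = false ∷ shift k p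

shift-cong : ∀ k {p q} → p ≋ q → shift k p ≋ shift k q
shift-cong zero    p≋q = p≋q
shift-cong (suc k) p≋q = ∷-cong refl (shift-cong k p≋q)

shift-≋0 : ∀ k {p} → shift k p ≋ 0ᵖ → p ≋ 0ᵖ
shift-≋0 zero    p≋0  = p≋0
shift-≋0 (suc k) rp≋0 = shift-≋0 k (coeffwise λ n → at rp≋0 (suc n))

shift-*ᵖ : ∀ k p q → shift k p *ᵖ q ≋ shift k (p *ᵖ q)
shift-*ᵖ zero    p q = ≋-refl
shift-*ᵖ (suc k) p q = ≋-trans (false∷-*ᵖ (shift k p) q) (∷-cong refl (shift-*ᵖ k p q))

shift-1ᵖ-*ᵖ : ∀ k q → shift k 1ᵖ *ᵖ q ≋ shift k q
shift-1ᵖ-*ᵖ k q = ≋-trans (shift-*ᵖ k 1ᵖ q) (shift-cong k (*ᵖ-identityˡ q))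

shift-[1+shift]-*ᵖ : ∀ m k q → shift m (1ᵖ +ᵖ shift k 1ᵖ) *ᵖ q ≋ shift m (q +ᵖ shift k q)
shift-[1+shift]-*ᵖ m k q = begin
  shift m (1ᵖ +ᵖ shift k 1ᵖ) *ᵖ q           ≈⟨ shift-*ᵖ m _ q ⟩
  shift m ((1ᵖ +ᵖ shift k 1ᵖ) *ᵖ q)         ≈⟨ shift-cong m (*ᵖ-distribʳ q 1ᵖ (shift k 1ᵖ)) ⟩
  shift m (1ᵖ *ᵖ q +ᵖ shift k 1ᵖ *ᵖ q)      ≈⟨ shift-cong m (+ᵖ-cong (*ᵖ-identityˡ q) (shift-1ᵖ-*ᵖ k q)) ⟩
  shift m (q +ᵖ shift k q)                  ∎

G² : Poly
G² = G *ᵖ G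

G²-*ᵖ : ∀ q → G² *ᵖ q ≋ shift 6 (q +ᵖ shift 2 q)
G²-*ᵖ q = begin
  G² *ᵖ q                            ≡⟨⟩
  shift 6 (1ᵖ +ᵖ shift 2 1ᵖ) *ᵖ q    ≈⟨ shift-[1+shift]-*ᵖ 6 2 q ⟩
  shift 6 (q +ᵖ shift 2 q)           ∎

[1+r²]-cancel : ∀ q → q +ᵖ shift 2 q ≋ 0ᵖ → q ≋ 0ᵖ
[1+r²]-cancel q q+r²q≋0 = coeffwise vanish
  where
  q≋r²q : q ≋ shift 2 q
  q≋r²q = +ᵖ≋0⇒≋ q+r²q≋0
  vanish : ∀ n → coeff q n ≡ false
  vanish zero          = at q≋r²q 0
  vanish (suc zero)    = at q≋r²q 1
  vanish (suc (suc n)) = trans (at q≋r²q (suc (suc n))) (vanish n)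

G²-cancel : ∀ q → G² *ᵖ q ≋ 0ᵖ → q ≋ 0ᵖ
G²-cancel q G²q≋0 = [1+r²]-cancel q (shift-≋0 6 (≋-trans (≋-sym (G²-*ᵖ q)) G²q≋0))

sumᵖ≡sum : ∀ k f → sumᵖ k f ≡ sum f
sumᵖ≡sum zero    f = refl
sumᵖ≡sum (suc k) f = cong (f zero +ᵖ_) (sumᵖ≡sum k (λ j → f (suc j)))

sumᵖ-cong : ∀ k {f g : Fin k → Poly} → (∀ j → f j ≋ g j) → sumᵖ k f ≋ sumᵖ k g
sumᵖ-cong k {f} {g} f≋g = begin
  sumᵖ k f   ≡⟨ sumᵖ≡sum k f ⟩
  sum f      ≈⟨ sum-cong-≋ f≋g ⟩
  sum g      ≡⟨ sumᵖ≡sum k g ⟨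
  sumᵖ k g   ∎

sumᵖ-zero : ∀ k → sumᵖ k (λ _ → 0ᵖ) ≋ 0ᵖ
sumᵖ-zero k = ≋-trans (≋-reflexive (sumᵖ≡sum k _)) (sum-replicate-zero k)

sumᵖ-+ᵖ : ∀ k (f g : Fin k → Poly) → sumᵖ k (λ j → f j +ᵖ g j) ≋ sumᵖ k f +ᵖ sumᵖ k g
sumᵖ-+ᵖ k f g = begin
  sumᵖ k (λ j → f j +ᵖ g j)   ≡⟨ sumᵖ≡sum k _ ⟩
  sum (λ j → f j +ᵖ g j)      ≈⟨ ∑-distrib-+ f g ⟩
  sum f +ᵖ sum g              ≡⟨ cong₂ _+ᵖ_ (sumᵖ≡sum k f) (sumᵖ≡sum k g) ⟨
  sumᵖ k f +ᵖ sumᵖ k g        ∎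

*ᵖ-sumᵖ : ∀ k q (f : Fin k → Poly) → q *ᵖ sumᵖ k f ≋ sumᵖ k (λ j → q *ᵖ f j)
*ᵖ-sumᵖ k q f = begin
  q *ᵖ sumᵖ k f               ≡⟨ cong (q *ᵖ_) (sumᵖ≡sum k f) ⟩
  q *ᵖ sum f                  ≈⟨ *-distribˡ-sum q f ⟩
  sum (λ j → q *ᵖ f j)        ≡⟨ sumᵖ≡sum k _ ⟨
  sumᵖ k (λ j → q *ᵖ f j)     ∎

sumᵖ-↑ : ∀ m n (f : Fin (m + n) → Poly) →
         sumᵖ (m + n) f ≋ sumᵖ m (λ i → f (i ↑ˡ n)) +ᵖ sumᵖ n (λ j → f (m ↑ʳ j))
sumᵖ-↑ zero    n f = ≋-refl
sumᵖ-↑ (suc m) n f = ≋-trans (+ᵖ-cong ≋-refl (sumᵖ-↑ m n (λ i → f (suc i)))) (≋-sym (+ᵖ-assoc (f zero) _ _))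

sumᵖ-combine : ∀ k l (f : Fin (k * l) → Poly) →
               sumᵖ (k * l) f ≋ sumᵖ k (λ i → sumᵖ l (λ j → f (combine i j)))
sumᵖ-combine zero    l f = ≋-refl
sumᵖ-combine (suc k) l f = ≋-trans (sumᵖ-↑ l (k * l) f) (+ᵖ-cong ≋-refl (sumᵖ-combine k l (λ x → f (l ↑ʳ x))))

lincomb-cong : ∀ {k} {c c′ : Fin k → Bool} {v w : Fin k → Poly} →
               (∀ j → c j ≡ c′ j) → (∀ j → v j ≋ w j) → lincomb c v ≋ lincomb c′ w
lincomb-cong {k} {c′ = c′} c≗c′ v≋w = sumᵖ-cong k λ j →
  ≋-trans (≋-reflexive (cong₂ scale (c≗c′ j) refl)) (scale-cong (c′ j) (v≋w j))

lincomb-zero : ∀ {k} {c : Fin k → Bool} (v : Fin k → Poly) → (∀ j → c j ≡ false) → lincomb c v ≋ 0ᵖ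
lincomb-zero {k} v c≗0 = ≋-trans (lincomb-cong c≗0 (λ _ → ≋-refl)) (≋-trans (sumᵖ-cong k (λ j → scale-false (v j))) (sumᵖ-zero k))

lincomb-*ᵖ : ∀ {k} (c : Fin k → Bool) q (v : Fin k → Poly) → lincomb c (λ j → q *ᵖ v j) ≋ q *ᵖ lincomb c v
lincomb-*ᵖ {k} c q v = ≋-trans (sumᵖ-cong k (λ j → *ᵖ-scale (c j) q (v j))) (≋-sym (*ᵖ-sumᵖ k q _))

lincomb-indicator : ∀ {k} (v : Fin k → Poly) j → lincomb (λ i → does (j ≟ i)) v ≋ v j
lincomb-indicator {suc k} v zero = begin
  scale true (v zero) +ᵖ lincomb (λ _ → false) (λ i → v (suc i))
    ≈⟨ +ᵖ-cong (≋-reflexive (scale-true (v zero))) (lincomb-zero (λ i → v (suc i)) (λ _ → refl)) ⟩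
  v zero +ᵖ 0ᵖ
    ≈⟨ +ᵖ-identityʳ (v zero) ⟩
  v zero
    ∎
lincomb-indicator {suc k} v (suc j) =
  ≋-trans (+ᵖ-cong (scale-false (v zero)) ≋-refl) (lincomb-indicator (λ i → v (suc i)) j)

lincomb₂ : ∀ {k l} → (Fin k → Fin l → Bool) → (Fin k → Fin l → Poly) → Poly
lincomb₂ {k} c v = sumᵖ k (λ i → lincomb (c i) (v i))

InSpan₂ : ∀ {k l} → (Fin k → Fin l → Poly) → Poly → Set
InSpan₂ {k} {l} v p = Σ[ c ∈ (Fin k → Fin l → Bool) ] p ≈ᵖ lincomb₂ c v

lincomb₂-cong : ∀ {k l} {c c′ : Fin k → Fin l → Bool} {v w : Fin k → Fin l → Poly} →
                (∀ i j → c i j ≡ c′ i j) → (∀ i j → v i j ≋ w i j) → lincomb₂ c v ≋ lincomb₂ c′ w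
lincomb₂-cong {k} c≗c′ v≋w = sumᵖ-cong k λ i → lincomb-cong (c≗c′ i) (v≋w i)

lincomb₂-head : ∀ {k l} (c : Fin k → Fin (suc l) → Bool) (v : Fin k → Fin (suc l) → Poly) →
  lincomb₂ c v ≋ lincomb (λ i → c i zero) (λ i → v i zero) +ᵖ lincomb₂ (λ i j → c i (suc j)) (λ i j → v i (suc j))
lincomb₂-head {k} c v = sumᵖ-+ᵖ k _ _

lincomb₂-*ᵖ : ∀ {k l} (c : Fin k → Fin l → Bool) q (v : Fin k → Fin l → Poly) →
              lincomb₂ c (λ i j → q *ᵖ v i j) ≋ q *ᵖ lincomb₂ c v
lincomb₂-*ᵖ {k} c q v = ≋-trans (sumᵖ-cong k (λ i → lincomb-*ᵖ (c i) q (v i))) (≋-sym (*ᵖ-sumᵖ k q _))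

flatten : ∀ {A : Set} {k l} → (Fin k → Fin l → A) → Fin (k * l) → A
flatten {l = l} f x = uncurry f (remQuot l x)

flatten-combine : ∀ {A : Set} {k l} (f : Fin k → Fin l → A) i j → flatten f (combine i j) ≡ f i j
flatten-combine f i j = cong (uncurry f) (remQuot-combine i j)

lincomb-flatten : ∀ {k l} (c : Fin (k * l) → Bool) (v : Fin k → Fin l → Poly) →
                  lincomb c (flatten v) ≋ lincomb₂ (λ i j → c (combine i j)) v
lincomb-flatten {k} {l} c v = ≋-trans (sumᵖ-combine k l _)
  (lincomb₂-cong (λ _ _ → refl) (λ i j → ≋-reflexive (flatten-combine v i j)))

hasDim-InSpan₂ : ∀ {k l} (v : Fin k → Fin l → Poly) →
  (∀ c → lincomb₂ c v ≋ 0ᵖ → ∀ i j → c i j ≡ false) → HasDim (InSpan₂ v) (k * l)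
hasDim-InSpan₂ {k} {l} v independent = flatten v , basis-in-span , basis-independent , basis-spans
  where
  basis-in-span : ∀ x → InSpan₂ v (flatten v x)
  basis-in-span x = (λ i j → does (x ≟ combine i j))
                  , at (≋-trans (≋-sym (lincomb-indicator (flatten v) x)) (lincomb-flatten _ v))
  basis-independent : LinIndep (flatten v)
  basis-independent c c≈0 x = subst (λ y → c y ≡ false) (combine-remQuot {k} l x)
    (independent _ (≋-trans (≋-sym (lincomb-flatten c v)) (coeffwise c≈0))
                   (proj₁ (remQuot {k} l x)) (proj₂ (remQuot {k} l x)))
  basis-spans : ∀ p → InSpan₂ v p → InSpan (flatten v) p
  basis-spans p (c , p≈) = flatten c , at (begin
    p                                             ≈⟨ coeffwise p≈ ⟩
    lincomb₂ c v                                  ≈⟨ lincomb₂-cong (λ i j → sym (flatten-combine c i j)) (λ _ _ → ≋-refl) ⟩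
    lincomb₂ (λ i j → flatten c (combine i j)) v  ≈⟨ lincomb-flatten (flatten c) v ⟨
    lincomb (flatten c) (flatten v)               ∎)

-- The subspaces {(r²+r)g(r²)}

stutter : List Bool → Poly
stutter []      = []
stutter (a ∷ g) = a ∷ a ∷ stutter g

stutter-+ᵖ : ∀ g h → stutter (g +ᵖ h) ≡ stutter g +ᵖ stutter h
stutter-+ᵖ []      h       = refl
stutter-+ᵖ (a ∷ g) []      = refl
stutter-+ᵖ (a ∷ g) (b ∷ h) = cong (λ s → (a xor b) ∷ (a xor b) ∷ s) (stutter-+ᵖ g h)

stutter-scale : ∀ a g → stutter (scale a g) ≡ scale a (stutter g)
stutter-scale a []      = refl
stutter-scale a (b ∷ g) = cong (λ s → (a ∧ b) ∷ (a ∧ b) ∷ s) (stutter-scale a g)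

stutter-padRight : ∀ {d} g (g≤d : length g ≤ d) → stutter (toList (padRight g≤d false (fromList g))) ≋ stutter g
stutter-padRight {d} [] z≤n = zeros d
  where
  zeros : ∀ n → stutter (toList (Vec.replicate n false)) ≋ 0ᵖ
  zeros zero    = ≋-refl
  zeros (suc n) = false∷-≋0 (false∷-≋0 (zeros n))
stutter-padRight (a ∷ g) (s≤s g≤d) = ∷-cong refl (∷-cong refl (stutter-padRight g g≤d))

length-+ᵖ : ∀ p q → length (p +ᵖ q) ≡ length p ⊔ length q
length-+ᵖ []      q       = refl
length-+ᵖ (a ∷ p) []      = refl
length-+ᵖ (a ∷ p) (b ∷ q) = cong suc (length-+ᵖ p q)

length-scale : ∀ a p → length (scale a p) ≡ length p
length-scale a []      = refl
length-scale a (b ∷ p) = cong suc (length-scale a p)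

-- p = (r²+r)g(r²) for a polynomial g given by at most d coefficients.
record Stuttered (d : ℕ) (p : Poly) : Set where
  constructor stuttered
  field
    {half}   : List Bool
    half≤    : length half ≤ d
    ≋stutter : p ≋ false ∷ stutter half

Stuttered-resp : ∀ {d p q} → p ≋ q → Stuttered d p → Stuttered d q
Stuttered-resp p≋q (stuttered g≤ p≋) = stuttered g≤ (≋-trans (≋-sym p≋q) p≋)

Stuttered-mono : ∀ {d d′ p} → d ≤ d′ → Stuttered d p → Stuttered d′ p
Stuttered-mono d≤d′ (stuttered g≤ p≋) = stuttered (≤-trans g≤ d≤d′) p≋

Stuttered-0 : ∀ {d} → Stuttered d 0ᵖ
Stuttered-0 = stuttered {half = []} z≤n (≋-sym (false∷-≋0 ≋-refl))

Stuttered-+ᵖ : ∀ {d p q} → Stuttered d p → Stuttered d q → Stuttered d (p +ᵖ q)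
Stuttered-+ᵖ (stuttered {g} g≤ p≋) (stuttered {h} h≤ q≋) =
  stuttered (≤-trans (≤-reflexive (length-+ᵖ g h)) (⊔-lub g≤ h≤))
            (≋-trans (+ᵖ-cong p≋ q≋) (∷-cong refl (≋-reflexive (sym (stutter-+ᵖ g h)))))

Stuttered-scale : ∀ {d p} a → Stuttered d p → Stuttered d (scale a p)
Stuttered-scale a (stuttered {g} g≤ p≋) =
  stuttered (≤-trans (≤-reflexive (length-scale a g)) g≤)
            (≋-trans (scale-cong a p≋) (∷-cong (∧-zeroʳ a) (≋-reflexive (sym (stutter-scale a g)))))

Stuttered-lincomb : ∀ {d k} (c : Fin k → Bool) (v : Fin k → Poly) →
                    (∀ j → Stuttered d (v j)) → Stuttered d (lincomb c v)
Stuttered-lincomb {k = zero}  c v v-st = Stuttered-0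
Stuttered-lincomb {k = suc k} c v v-st = Stuttered-+ᵖ (Stuttered-scale (c zero) (v-st zero))
  (Stuttered-lincomb (λ j → c (suc j)) (λ j → v (suc j)) (λ j → v-st (suc j)))

Stuttered-G² : ∀ {d p} → Stuttered d p → Stuttered (4 + d) (G² *ᵖ p)
Stuttered-G² {d} {p} (stuttered {g} g≤ p≋) = stuttered {half = shift 3 (g +ᵖ (false ∷ g))} length≤ (begin
  G² *ᵖ p                                                    ≈⟨ *ᵖ-congʳ G² p≋ ⟩
  G² *ᵖ (false ∷ stutter g)                                  ≈⟨ G²-*ᵖ (false ∷ stutter g) ⟩
  shift 7 (stutter g +ᵖ stutter (false ∷ g))                 ≈⟨ shift-cong 7 (≋-reflexive (sym (stutter-+ᵖ g (false ∷ g)))) ⟩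
  false ∷ stutter (shift 3 (g +ᵖ (false ∷ g)))               ∎)
  where
  length≤ : length (shift 3 (g +ᵖ (false ∷ g))) ≤ 4 + d
  length≤ = s≤s (s≤s (s≤s (≤-trans (≤-reflexive (length-+ᵖ g (false ∷ g))) (⊔-lub (m≤n⇒m≤1+n g≤) (s≤s g≤)))))

spread : List Bool → Poly
spread []      = []
spread (a ∷ g) = a ∷ false ∷ spread g

compose-r² : ∀ g → compose g (X ^ᵖ 2) ≋ spread g
compose-r² []      = ≋-refl
compose-r² (a ∷ g) = begin
  (a ∷ []) +ᵖ X ^ᵖ 2 *ᵖ compose g (X ^ᵖ 2)   ≈⟨ +ᵖ-cong (≋-refl {a ∷ []}) (≋-trans (shift-1ᵖ-*ᵖ 2 _) (shift-cong 2 (compose-r² g))) ⟩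
  (a ∷ []) +ᵖ shift 2 (spread g)            ≈⟨ ∷-cong (xor-identityʳ a) ≋-refl ⟩
  a ∷ false ∷ spread g                      ∎

spread-+ᵖ-shift : ∀ g → spread g +ᵖ shift 1 (spread g) ≋ stutter g
spread-+ᵖ-shift []      = false∷-≋0 ≋-refl
spread-+ᵖ-shift (a ∷ g) = ∷-cong (xor-identityʳ a) (∷-cong refl (spread-+ᵖ-shift g))

[r²+r]-*ᵖ-compose : ∀ g → (X ^ᵖ 2 +ᵖ X) *ᵖ compose g (X ^ᵖ 2) ≋ false ∷ stutter g
[r²+r]-*ᵖ-compose g = begin
  (X ^ᵖ 2 +ᵖ X) *ᵖ compose g (X ^ᵖ 2)      ≈⟨ *ᵖ-congʳ (X ^ᵖ 2 +ᵖ X) (compose-r² g) ⟩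
  shift 1 (1ᵖ +ᵖ shift 1 1ᵖ) *ᵖ spread g   ≈⟨ shift-[1+shift]-*ᵖ 1 1 (spread g) ⟩
  false ∷ (spread g +ᵖ shift 1 (spread g)) ≈⟨ ∷-cong refl (spread-+ᵖ-shift g) ⟩
  false ∷ stutter g                        ∎

Stuttered⇒L*-form : ∀ {d p} → Stuttered d p →
                    Σ[ g ∈ Vec Bool d ] p ≈ᵖ (X ^ᵖ 2 +ᵖ X) *ᵖ compose (toList g) (X ^ᵖ 2)
Stuttered⇒L*-form {d} {p} (stuttered {g} g≤ p≋) = gᵈ , at (begin
  p                                              ≈⟨ p≋ ⟩
  false ∷ stutter g                              ≈⟨ ∷-cong refl (stutter-padRight g g≤) ⟨
  false ∷ stutter (toList gᵈ)                    ≈⟨ [r²+r]-*ᵖ-compose (toList gᵈ) ⟨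
  (X ^ᵖ 2 +ᵖ X) *ᵖ compose (toList gᵈ) (X ^ᵖ 2)  ∎)
  where
  gᵈ : Vec Bool d
  gᵈ = padRight g≤ false (fromList g)

-- The spanning vectors of L

term : Fin 3 → ℕ → Poly
term i n = u i *ᵖ G ^ᵖ (2 * n)

term₀ : Fin 3 → Poly
term₀ i = term i 0

terms : ∀ {l} → Fin 3 → Fin l → Poly
terms i n = term i (toℕ n)

term-suc : ∀ i n → term i (suc n) ≋ G² *ᵖ term i n
term-suc i n = begin
  u i *ᵖ G ^ᵖ (2 * suc n)               ≡⟨ cong (λ e → u i *ᵖ G ^ᵖ e) (*-suc 2 n) ⟩
  u i *ᵖ (G *ᵖ (G *ᵖ G ^ᵖ (2 * n)))     ≈⟨ *ᵖ-congʳ (u i) (*ᵖ-assoc G G _) ⟨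
  u i *ᵖ (G² *ᵖ G ^ᵖ (2 * n))           ≈⟨ *ᵖ-leftComm (u i) G² _ ⟩
  G² *ᵖ (u i *ᵖ G ^ᵖ (2 * n))           ∎

-- u₀ = (r²+r)·r², u₁ = (r²+r)(1+r²), u₂ = (r²+r)(r⁴+r⁶), where the product defining u₂
-- leaves two trailing zero coefficients.
term₀-stuttered : ∀ i → Stuttered 4 (term₀ i)
term₀-stuttered zero             = stuttered {half = false ∷ true ∷ []} (s≤s (s≤s z≤n)) ≋-refl
term₀-stuttered (suc zero)       = stuttered {half = true ∷ true ∷ []} (s≤s (s≤s z≤n)) ≋-refl
term₀-stuttered (suc (suc zero)) = stuttered {half = g₂} (s≤s (s≤s (s≤s (s≤s z≤n))))
  (∷-cong refl (stutter-padRight {6} g₂ (s≤s (s≤s (s≤s (s≤s z≤n))))))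
  where
  g₂ : List Bool
  g₂ = false ∷ false ∷ true ∷ true ∷ []

lincomb-term₀-low-coeffs⇒0 : ∀ (a : Fin 3 → Bool) → let p = lincomb a term₀ in
  coeff p 1 ≡ false → coeff p 3 ≡ false → coeff p 5 ≡ false →
  a zero ≡ false × a (suc zero) ≡ false × a (suc (suc zero)) ≡ false
lincomb-term₀-low-coeffs⇒0 a h₁ h₃ h₅ with a zero | a (suc zero) | a (suc (suc zero))
... | false | false | false = refl , refl , refl
lincomb-term₀-low-coeffs⇒0 a _  _  () | false | false | true
lincomb-term₀-low-coeffs⇒0 a () _  _  | false | true  | false
lincomb-term₀-low-coeffs⇒0 a () _  _  | false | true  | true
lincomb-term₀-low-coeffs⇒0 a _  () _  | true  | false | false
lincomb-term₀-low-coeffs⇒0 a _  () _  | true  | false | true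
lincomb-term₀-low-coeffs⇒0 a () _  _  | true  | true  | false
lincomb-term₀-low-coeffs⇒0 a () _  _  | true  | true  | true

lincomb₂-terms-suc : ∀ {l} (c : Fin 3 → Fin (suc l) → Bool) →
  lincomb₂ c terms ≋ lincomb (λ i → c i zero) term₀ +ᵖ G² *ᵖ lincomb₂ (λ i n → c i (suc n)) terms
lincomb₂-terms-suc {l} c = begin
  lincomb₂ c terms
    ≈⟨ lincomb₂-head c terms ⟩
  lincomb c₀ term₀ +ᵖ lincomb₂ c′ (λ i n → term i (suc (toℕ n)))
    ≈⟨ +ᵖ-cong (≋-refl {lincomb c₀ term₀}) (lincomb₂-cong {c = c′} (λ _ _ → refl) (λ i n → term-suc i (toℕ n))) ⟩
  lincomb c₀ term₀ +ᵖ lincomb₂ c′ (λ i n → G² *ᵖ terms i n)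
    ≈⟨ +ᵖ-cong (≋-refl {lincomb c₀ term₀}) (lincomb₂-*ᵖ c′ G² terms) ⟩
  lincomb c₀ term₀ +ᵖ G² *ᵖ lincomb₂ c′ terms
    ∎
  where
  c₀ : Fin 3 → Bool
  c₀ i = c i zero
  c′ : Fin 3 → Fin l → Bool
  c′ i n = c i (suc n)

terms-independent : ∀ {l} (c : Fin 3 → Fin l → Bool) → lincomb₂ c terms ≋ 0ᵖ → ∀ i n → c i n ≡ false
terms-independent {zero}  c _   i ()
terms-independent {suc l} c c≋0 = vanish
  where
  c₀ : Fin 3 → Bool
  c₀ i = c i zero
  c′ : Fin 3 → Fin l → Bool
  c′ i n = c i (suc n)
  rest : Poly
  rest = lincomb₂ c′ terms
  head≋G²rest : lincomb c₀ term₀ ≋ G² *ᵖ rest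
  head≋G²rest = +ᵖ≋0⇒≋ (≋-trans (≋-sym (lincomb₂-terms-suc c)) c≋0)
  head≋r⁶ : lincomb c₀ term₀ ≋ shift 6 (rest +ᵖ shift 2 rest)
  head≋r⁶ = ≋-trans head≋G²rest (G²-*ᵖ rest)
  heads : c zero zero ≡ false × c (suc zero) zero ≡ false × c (suc (suc zero)) zero ≡ false
  heads = lincomb-term₀-low-coeffs⇒0 c₀ (at head≋r⁶ 1) (at head≋r⁶ 3) (at head≋r⁶ 5)
  heads-vanish : ∀ i → c i zero ≡ false
  heads-vanish zero             = proj₁ heads
  heads-vanish (suc zero)       = proj₁ (proj₂ heads)
  heads-vanish (suc (suc zero)) = proj₂ (proj₂ heads)
  rest≋0 : rest ≋ 0ᵖ
  rest≋0 = G²-cancel rest (≋-trans (≋-sym head≋G²rest) (lincomb-zero term₀ heads-vanish))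
  vanish : ∀ i n → c i n ≡ false
  vanish i zero    = heads-vanish i
  vanish i (suc n) = terms-independent c′ rest≋0 i n

terms-stuttered : ∀ {l} (c : Fin 3 → Fin l → Bool) → Stuttered (4 * l) (lincomb₂ c terms)
terms-stuttered {zero}  c = Stuttered-0
terms-stuttered {suc l} c = Stuttered-resp (≋-sym (lincomb₂-terms-suc c)) (Stuttered-+ᵖ head tail)
  where
  c′ : Fin 3 → Fin l → Bool
  c′ i n = c i (suc n)
  head : Stuttered (4 * suc l) (lincomb (λ i → c i zero) term₀)
  head = Stuttered-mono (m≤m*n 4 (suc l)) (Stuttered-lincomb (λ i → c i zero) term₀ term₀-stuttered)
  tail : Stuttered (4 * suc l) (G² *ᵖ lincomb₂ c′ terms)
  tail = subst (λ d → Stuttered d (G² *ᵖ lincomb₂ c′ terms)) (sym (*-suc 4 l)) (Stuttered-G² (terms-stuttered c′))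

*-suc′ : ∀ k m → k * suc m ≡ k * m + k
*-suc′ k m = trans (*-suc k m) (+-comm k (k * m))

lemma2p7 : (m : ℕ) → HasDim (L m) (3 * m + 3) × (∀ p → L m p → L* m p)
lemma2p7 m = subst (HasDim (L m)) (*-suc′ 3 m) (hasDim-InSpan₂ terms terms-independent)
           , λ p (c , p≈) → Stuttered⇒L*-form
               (subst (λ d → Stuttered d p) (*-suc′ 4 m)
                      (Stuttered-resp (≋-sym (coeffwise p≈)) (terms-stuttered c)))
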